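{- With $\delta(2,50)$ as defined in the context, \[ \delta(2,50)\ \ge\ \frac{1}{49}\prod_{p\le 50}\left(1-\frac1p\right)\ >\ \frac{1}{354}, \] where the product is over primes $p\le 50$.
   Context: A set of integers is admissible if for every prime $p$ its elements do not cover all residue classes modulo $p$. For integers $k\ge m\ge1$, a set $A\subset\mathbb{Z}^m$ is called $(m,k)$-plausible if: (i) $(h_1,\dots,h_m)\in A$ and $t\in\mathbb{Z}$ imply $(h_1+t,\dots,h_m+t)\in A$; (ii) $(h_1,\dots,h_m)\in A$ and $\sigma\in S_m$ imply $(h_{\sigma(1)},\dots,h_{\sigma(m)})\in A$; (iii) for every admissible set $\{x_1,\dots,x_k\}$ of $k$ distinct integers there exist distinct $h_1,\dots,h_m\in\{x_1,\dots,x_k\}$ with $(h_1,\dots,h_m)\in A$. Define $\delta(m,k)=\inf\{\liminf_{N\to\infty}|A\cap[-N,N]^m|/(2N)^m: A\subset\mathbb{Z}^m \text{ is } (m,k)\text{ -plausible}\}$. -}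

module Defs where

open import Data.Nat as ℕ using (ℕ; zero; suc; _≤_)
open import Data.Nat.Primality using (Prime; prime?)
open import Data.Integer as ℤ using (ℤ; +_; -_; _-_)
open import Data.Integer.Divisibility using (_∣_)
open import Data.Rational as ℚ using (ℚ; _/_; 1ℚ)
open import Data.Fin using (Fin)
open import Data.Product using (_×_; _,_; Σ; ∃; proj₁; proj₂)
open import Data.List using (List; length; filter; upTo; foldr)
open import Data.List.Relation.Unary.All using (All)
open import Data.List.Relation.Unary.Unique.Propositional using (Unique)
open import Function.Definitions using (Injective)
open import Relation.Binary.PropositionalEquality using (_≡_; _≢_)
open import Relation.Nullary using (¬_)

Admissible : {k : ℕ} → (Fin k → ℤ) → Set
Admissible {k} x = (p : ℕ) → Prime p →
  Σ ℤ (λ r → (i : Fin k) → ¬ ((+ p) ∣ (x i - r)))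

Plausible2 : ℕ → (ℤ × ℤ → Set) → Set
Plausible2 k A =
  ((h₁ h₂ t : ℤ) → A (h₁ , h₂) → A (h₁ ℤ.+ t , h₂ ℤ.+ t)) ×
  ((h₁ h₂ : ℤ) → A (h₁ , h₂) → A (h₂ , h₁)) ×
  ((x : Fin k → ℤ) → Injective _≡_ _≡_ x → Admissible x →
     Σ (Fin k) (λ i → Σ (Fin k) (λ j → i ≢ j × A (x i , x j))))

InBox : ℕ → ℤ → Set
InBox N z = (- (+ N)) ℤ.≤ z × z ℤ.≤ (+ N)

-- "|A ∩ [-N,N]²| ≥ q·(2N)²": there is a duplicate-free list of points of
-- A ∩ [-N,N]² whose length is at least q·(2N)².
CountAtLeast : (ℤ × ℤ → Set) → ℕ → ℚ → Set
CountAtLeast A N q = Σ (List (ℤ × ℤ)) λ L →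
  Unique L ×
  All (λ z → A z × InBox N (proj₁ z) × InBox N (proj₂ z)) L ×
  q ℚ.* ((+ ((2 ℕ.* N) ℕ.* (2 ℕ.* N))) / 1) ℚ.≤ ((+ length L) / 1)

-- liminf_{N→∞} |A ∩ [-N,N]²| / (2N)² ≥ c
LiminfDensity≥ : (ℤ × ℤ → Set) → ℚ → Set
LiminfDensity≥ A c = (ε : ℚ) → ℚ.0ℚ ℚ.< ε →
  Σ ℕ λ N₀ → (N : ℕ) → N₀ ≤ N → CountAtLeast A N (c ℚ.- ε)

-- 1 - 1/p  (= (p-1)/p), with a harmless value at p = 0
oneMinusInv : ℕ → ℚ
oneMinusInv zero = 1ℚ
oneMinusInv (suc q) = (+ q) / suc q

primesUpTo50 : List ℕ
primesUpTo50 = filter prime? (upTo 51)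

bound : ℚ
bound = ((+ 1) / 49) ℚ.* foldr (λ p acc → oneMinusInv p ℚ.* acc) 1ℚ primesUpTo50

module Submission where

-- Let P = ∏_{p ≤ 47} p and call n sieved when no prime p ≤ 50 divides it.  Any
-- 50 distinct sieved numbers form an admissible set, so a (2, 50)-plausible set
-- A contains one of their pairs, and by translation invariance that pair's
-- difference d is a full difference: (h, h + d) ∈ A for every h.  Among more
-- than 49·(|D| + 1) sieved numbers one can greedily choose 50 whose pairwise
-- differences avoid a given list D, so full differences can be harvested as long
-- as sieved numbers are plentiful; by the sieve estimate every window of P
-- consecutive numbers contains ∏ (p − 1) = 49β of them.  Hence in round j one
-- finds β new full differences below (j + 2)·P.  Each full difference d gives
-- 2·(2N + 1 − d) points of A in [−N, N]², and summing the arithmetic progression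
-- yields density at least β/P, which equals the stated bound.

module FiniteSums where

  open import Data.Nat
  open import Data.Nat.Properties
  open import Data.Bool using (if_then_else_)
  open import Function using (_∘_)
  open import Function.Bundles using (_⇔_)
  open import Relation.Nullary using (¬_; Dec; yes; no; does; ¬?; contradiction)
  open import Relation.Nullary.Decidable using (_×-dec_; does-⇔)
  open import Relation.Binary.PropositionalEquality
  open import Algebra.Properties.CommutativeSemigroup +-commutativeSemigroup
    using (interchange)

  indicator : {P : Set} → Dec P → ℕ
  indicator P? = if does P? then 1 else 0

  indicator-× : {P Q : Set} (P? : Dec P) (Q? : Dec Q) →
                indicator (P? ×-dec Q?) ≡ indicator P? * indicator Q?
  indicator-× (yes _) Q? = sym (+-identityʳ (indicator Q?))
  indicator-× (no _)  Q? = refl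

  indicator-⇔ : {P Q : Set} → P ⇔ Q → (P? : Dec P) (Q? : Dec Q) → indicator P? ≡ indicator Q?
  indicator-⇔ P⇔Q P? Q? = cong (λ b → if b then 1 else 0) (does-⇔ P⇔Q P? Q?)

  ∑< : ℕ → (ℕ → ℕ) → ℕ
  ∑< zero    f = 0
  ∑< (suc n) f = f 0 + ∑< n (f ∘ suc)

  ∑-cong : ∀ n {f g : ℕ → ℕ} → (∀ i → f i ≡ g i) → ∑< n f ≡ ∑< n g
  ∑-cong zero    f≡g = refl
  ∑-cong (suc n) f≡g = cong₂ _+_ (f≡g 0) (∑-cong n (f≡g ∘ suc))

  ∑-mono : ∀ n {f g : ℕ → ℕ} → (∀ i → f i ≤ g i) → ∑< n f ≤ ∑< n g
  ∑-mono zero    f≤g = z≤n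
  ∑-mono (suc n) f≤g = +-mono-≤ (f≤g 0) (∑-mono n (f≤g ∘ suc))

  ∑-const : ∀ n c → ∑< n (λ _ → c) ≡ n * c
  ∑-const zero    c = refl
  ∑-const (suc n) c = cong (c +_) (∑-const n c)

  ∑-+ : ∀ n (f g : ℕ → ℕ) → ∑< n (λ i → f i + g i) ≡ ∑< n f + ∑< n g
  ∑-+ zero    f g = refl
  ∑-+ (suc n) f g = trans (cong ((f 0 + g 0) +_) (∑-+ n (f ∘ suc) (g ∘ suc)))
                          (interchange (f 0) (g 0) (∑< n (f ∘ suc)) (∑< n (g ∘ suc)))

  ∑-*ˡ : ∀ n c (f : ℕ → ℕ) → ∑< n (λ i → c * f i) ≡ c * ∑< n f
  ∑-*ˡ zero    c f = sym (*-zeroʳ c)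
  ∑-*ˡ (suc n) c f = trans (cong (c * f 0 +_) (∑-*ˡ n c (f ∘ suc)))
                           (sym (*-distribˡ-+ c (f 0) _))

  ∑-*ʳ : ∀ n c (f : ℕ → ℕ) → ∑< n (λ i → f i * c) ≡ ∑< n f * c
  ∑-*ʳ n c f = begin
    ∑< n (λ i → f i * c) ≡⟨ ∑-cong n (λ i → *-comm (f i) c) ⟩
    ∑< n (λ i → c * f i) ≡⟨ ∑-*ˡ n c f ⟩
    c * ∑< n f           ≡⟨ *-comm c (∑< n f) ⟩
    ∑< n f * c           ∎
    where open ≡-Reasoning

  ∑-split : ∀ m n (f : ℕ → ℕ) → ∑< (m + n) f ≡ ∑< m f + ∑< n (λ i → f (m + i))
  ∑-split zero    n f = refl
  ∑-split (suc m) n f = trans (cong (f 0 +_) (∑-split m n (f ∘ suc)))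
                              (sym (+-assoc (f 0) _ _))

  ∑-last : ∀ n (f : ℕ → ℕ) → ∑< (suc n) f ≡ ∑< n f + f n
  ∑-last zero    f = +-identityʳ (f 0)
  ∑-last (suc n) f = trans (cong (f 0 +_) (∑-last n (f ∘ suc))) (sym (+-assoc (f 0) _ _))

  ∑-blocks : ∀ q P (f : ℕ → ℕ) → ∑< (q * P) f ≡ ∑< q (λ j → ∑< P (λ r → f (j * P + r)))
  ∑-blocks zero    P f = refl
  ∑-blocks (suc q) P f = begin
    ∑< (P + q * P) f
      ≡⟨ ∑-split P (q * P) f ⟩
    ∑< P f + ∑< (q * P) (λ i → f (P + i))
      ≡⟨ cong (∑< P f +_) (∑-blocks q P (λ i → f (P + i))) ⟩
    ∑< P f + ∑< q (λ j → ∑< P (λ r → f (P + (j * P + r))))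
      ≡⟨ cong (∑< P f +_) (∑-cong q (λ j → ∑-cong P (λ r → cong f (sym (+-assoc P (j * P) r))))) ⟩
    ∑< P f + ∑< q (λ j → ∑< P (λ r → f (suc j * P + r))) ∎
    where open ≡-Reasoning

  ∑-swap : ∀ m n (F : ℕ → ℕ → ℕ) →
           ∑< m (λ j → ∑< n (λ r → F j r)) ≡ ∑< n (λ r → ∑< m (λ j → F j r))
  ∑-swap zero    n F = sym (trans (∑-const n 0) (*-zeroʳ n))
  ∑-swap (suc m) n F = trans (cong (∑< n (F 0) +_) (∑-swap m n (F ∘ suc)))
                             (sym (∑-+ n (F 0) (λ r → ∑< m (λ j → F (suc j) r))))

  ∑-indicator-all : ∀ n {P : ℕ → Set} (P? : ∀ i → Dec (P i)) →
                    (∀ i → i < n → P i) → ∑< n (λ i → indicator (P? i)) ≡ n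
  ∑-indicator-all zero    P? all = refl
  ∑-indicator-all (suc n) P? all with P? 0
  ... | yes _  = cong suc (∑-indicator-all n (P? ∘ suc) (λ i i<n → all (suc i) (s≤s i<n)))
  ... | no ¬p0 = contradiction (all 0 z<s) ¬p0

  at-most-once⇒∑≥ : ∀ n {P : ℕ → Set} (P? : ∀ i → Dec (P i)) →
    (∀ i j → i < n → j < n → P i → P j → i ≡ j) →
    n ≤ suc (∑< n (λ i → indicator (¬? (P? i))))
  at-most-once⇒∑≥ zero    P? once = z≤n
  at-most-once⇒∑≥ (suc n) {P} P? once with P? 0
  ... | yes p₀ = s≤s (≤-reflexive (sym (∑-indicator-all n (¬? ∘ P? ∘ suc) others)))
    where
    others : ∀ i → i < n → ¬ P (suc i)
    others i i<n pᵢ with () ← once 0 (suc i) z<s (s≤s i<n) p₀ pᵢ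
  ... | no _ = s≤s (at-most-once⇒∑≥ n (P? ∘ suc) once′)
    where
    once′ : ∀ i j → i < n → j < n → P (suc i) → P (suc j) → i ≡ j
    once′ i j i<n j<n pᵢ pⱼ = suc-injective (once (suc i) (suc j) (s≤s i<n) (s≤s j<n) pᵢ pⱼ)

module Sieve where

  open FiniteSums
  open import Data.Nat
  open import Data.Nat.Properties
  open import Data.Nat.Divisibility
  open import Data.Nat.Primality
  open import Data.Nat.ListAction using (product)
  open import Data.List using (List; []; _∷_; map)
  open import Data.List.Relation.Unary.All as All using (All; []; _∷_; all?)
  open import Data.List.Relation.Unary.Any using (here; there)
  open import Data.List.Relation.Unary.Unique.Propositional using (Unique; []; _∷_)
  open import Data.List.Membership.Propositional using (_∈_)
  open import Data.Nat.ListAction.Properties using (∈⇒∣product; product≢0)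
  open import Data.List.Relation.Unary.All.Properties using (map⁺)
  open import Data.Product using (_×_; _,_)
  open import Data.Sum using (inj₁; inj₂)
  open import Function.Bundles using (mk⇔)
  open import Relation.Binary.Definitions using (tri<; tri≈; tri>)
  open import Relation.Nullary using (¬_; Dec; ¬?; contradiction)
  open import Relation.Nullary.Decidable using (_×-dec_)
  open import Relation.Binary.PropositionalEquality

  Sieved : List ℕ → ℕ → Set
  Sieved qs n = All (λ q → ¬ q ∣ n) qs

  sieved? : ∀ qs n → Dec (Sieved qs n)
  sieved? qs n = all? (λ q → ¬? (q ∣? n)) qs

  DistinctPrimes : List ℕ → Set
  DistinctPrimes qs = All Prime qs × Unique qs

  sieved-periodic : ∀ qs n {m} → All (_∣ m) qs →
                    indicator (sieved? qs (n + m)) ≡ indicator (sieved? qs n)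
  sieved-periodic qs n {m} qs∣m = indicator-⇔
    (mk⇔ (λ s → All.zipWith drop (s , qs∣m)) (λ s → All.zipWith add (s , qs∣m)))
    (sieved? qs (n + m)) (sieved? qs n)
    where
    drop : ∀ {q} → ¬ q ∣ n + m × q ∣ m → ¬ q ∣ n
    drop (q∤n+m , q∣m) q∣n = q∤n+m (∣m∣n⇒∣m+n q∣n q∣m)
    add : ∀ {q} → ¬ q ∣ n × q ∣ m → ¬ q ∣ n + m
    add {q} (q∤n , q∣m) q∣n+m = q∤n (∣m+n∣m⇒∣n (subst (q ∣_) (+-comm n m) q∣n+m) q∣m)

  prime⇒≢1 : ∀ {q} → Prime q → q ≢ 1
  prime⇒≢1 (prime {{nontrivial}} _) = nonTrivial⇒≢1 {{nontrivial}}

  prime∣product⇒∈ : ∀ {q ps} → Prime q → All Prime ps → q ∣ product ps → q ∈ ps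
  prime∣product⇒∈ {q} {[]} q-prime [] q∣1 = contradiction (∣1⇒≡1 q∣1) (prime⇒≢1 q-prime)
  prime∣product⇒∈ {q} {p ∷ ps} q-prime (p-prime ∷ ps-prime) q∣p*rest
    with euclidsLemma p (product ps) q-prime q∣p*rest
  ... | inj₂ q∣rest = there (prime∣product⇒∈ q-prime ps-prime q∣rest)
  ... | inj₁ q∣p with prime⇒irreducible p-prime q∣p
  ...   | inj₂ q≡p = here q≡p
  ...   | inj₁ q≡1 = contradiction q≡1 (prime⇒≢1 q-prime)

  -- In an arithmetic progression whose step P is prime to the prime q, two
  -- terms fewer than q steps apart are never both divisible by q: q would
  -- divide their difference m·P.
  progression-gap : ∀ {q P} c i {m} → Prime q → ¬ q ∣ P → 0 < m → m < q →
                      q ∣ c + i * P → ¬ q ∣ c + (i + m) * P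
  progression-gap {q} {P} c i {m@(suc _)} q-prime q∤P _ m<q q∣i q∣i+m
    with euclidsLemma m P q-prime (∣m+n∣m⇒∣n (subst (q ∣_) split q∣i+m) q∣i)
    where
    split : c + (i + m) * P ≡ (c + i * P) + m * P
    split = trans (cong (c +_) (*-distribʳ-+ P i m)) (sym (+-assoc c (i * P) (m * P)))
  ... | inj₁ q∣m = <⇒≱ m<q (∣⇒≤ q∣m)
  ... | inj₂ q∣P = q∤P q∣P

  progression-apart : ∀ {q P} c {i j} → Prime q → ¬ q ∣ P → i < j → j < q →
                       q ∣ c + i * P → ¬ q ∣ c + j * P
  progression-apart {q} {P} c {i} {j} q-prime q∤P i<j j<q q∣i q∣j =
    progression-gap c i q-prime q∤P (m<n⇒0<n∸m i<j) (≤-<-trans (m∸n≤m j i) j<q) q∣i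
      (subst (λ k → q ∣ c + k * P) (sym (m+[n∸m]≡n (<⇒≤ i<j))) q∣j)

  progression-sieve : ∀ {q P} c → Prime q → ¬ q ∣ P →
                      pred q ≤ ∑< q (λ j → indicator (¬? (q ∣? c + j * P)))
  progression-sieve {q} {P} c q-prime q∤P = pred-mono-≤ (at-most-once⇒∑≥ q (λ j → q ∣? c + j * P) once)
    where
    once : ∀ i j → i < q → j < q → q ∣ c + i * P → q ∣ c + j * P → i ≡ j
    once i j i<q j<q q∣i q∣j with <-cmp i j
    ... | tri< i<j _ _ = contradiction q∣j (progression-apart c q-prime q∤P i<j j<q q∣i)
    ... | tri≈ _ i≡j _ = i≡j
    ... | tri> _ _ j<i = contradiction q∣i (progression-apart c q-prime q∤P j<i i<q q∣j)

  -- Induction on qs: a window for q ∷ qs consists of q windows for qs, and in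
  -- each residue class modulo ∏ qs at least q − 1 of the q members escape q.
  sieve : ∀ qs → DistinctPrimes qs → ∀ a →
          product (map pred qs) ≤ ∑< (product qs) (λ i → indicator (sieved? qs (a + i)))
  sieve []       _ a = ≤-refl
  sieve (q ∷ qs) (q-prime ∷ qs-prime , q∉qs ∷ qs-unique) a = begin
    pred q * product (map pred qs)
      ≤⟨ *-monoʳ-≤ (pred q) (sieve qs (qs-prime , qs-unique) a) ⟩
    pred q * ∑< P g
      ≡⟨ ∑-*ˡ P (pred q) g ⟨
    ∑< P (λ r → pred q * g r)
      ≤⟨ ∑-mono P (λ r → *-monoˡ-≤ (g r) (progression-sieve (a + r) q-prime q∤P)) ⟩
    ∑< P (λ r → ∑< q (λ j → escapes r j) * g r)
      ≡⟨ ∑-cong P (λ r → ∑-*ʳ q (g r) (escapes r)) ⟨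
    ∑< P (λ r → ∑< q (λ j → escapes r j * g r))
      ≡⟨ ∑-cong P (λ r → ∑-cong q (λ j → factorise j r)) ⟨
    ∑< P (λ r → ∑< q (λ j → f (j * P + r)))
      ≡⟨ ∑-swap q P (λ j r → f (j * P + r)) ⟨
    ∑< q (λ j → ∑< P (λ r → f (j * P + r)))
      ≡⟨ ∑-blocks q P f ⟨
    ∑< (q * P) f ∎
    where
    open ≤-Reasoning
    P : ℕ
    P = product qs
    q∤P : ¬ q ∣ P
    q∤P q∣P = All.lookup q∉qs (prime∣product⇒∈ q-prime qs-prime q∣P) refl
    g : ℕ → ℕ
    g r = indicator (sieved? qs (a + r))
    escapes : ℕ → ℕ → ℕ
    escapes r j = indicator (¬? (q ∣? (a + r) + j * P))
    f : ℕ → ℕ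
    f i = indicator (sieved? (q ∷ qs) (a + i))
    factorise : ∀ j r → f (j * P + r) ≡ escapes r j * g r
    factorise j r = begin-equality
      f (j * P + r)
        ≡⟨ cong (λ n → indicator (sieved? (q ∷ qs) n)) reorder ⟩
      indicator (¬? (q ∣? n) ×-dec sieved? qs n)
        ≡⟨ indicator-× (¬? (q ∣? n)) (sieved? qs n) ⟩
      escapes r j * indicator (sieved? qs n)
        ≡⟨ cong (escapes r j *_) (sieved-periodic qs (a + r) qs∣jP) ⟩
      escapes r j * g r ∎
      where
      n : ℕ
      n = (a + r) + j * P
      reorder : a + (j * P + r) ≡ n
      reorder = trans (cong (a +_) (+-comm (j * P) r)) (sym (+-assoc a r (j * P)))
      qs∣jP : All (_∣ j * P) qs
      qs∣jP = All.tabulate (λ q∈qs → ∣-trans (∈⇒∣product q∈qs) (n∣m*n j))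

  product-nonZero : ∀ {qs} → DistinctPrimes qs → NonZero (product qs)
  product-nonZero (qs-prime , _) = productOfPrimes≢0 qs-prime

  totient-positive : ∀ {qs} → DistinctPrimes qs → 0 < product (map pred qs)
  totient-positive {qs} (qs-prime , _) =
    >-nonZero⁻¹ _ {{product≢0 (map⁺ (All.map pred-nonZero qs-prime))}}
    where
    pred-nonZero : ∀ {p} → Prime p → NonZero (pred p)
    pred-nonZero {p} p-prime = >-nonZero (suc[m]≤n⇒m≤pred[n] (nonTrivial⇒n>1 p {{prime⇒nonTrivial p-prime}}))

module SievedNumbers where

  open FiniteSums
  open Sieve
  open import Data.Nat
  open import Data.Nat.Properties
  open import Data.Nat.ListAction using (product)
  open import Data.List using (List; []; _∷_; length; map; filter; applyUpTo; upTo)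
  open import Data.List.Relation.Unary.All as All using (All; []; _∷_)
  open import Data.List.Relation.Unary.Any using (here; there)
  open import Data.List.Relation.Unary.AllPairs using (AllPairs; []; _∷_)
  import Data.List.Relation.Unary.AllPairs.Properties as AllPairs
  open import Data.List.Relation.Unary.Unique.Propositional using (Unique; []; _∷_)
  import Data.List.Relation.Unary.Unique.Propositional.Properties as Unique
  open import Data.List.Membership.Propositional using (_∈_)
  open import Data.List.Membership.Propositional.Properties using (∈-filter⁻; ∈-upTo⁻)
  open import Data.Product using (_×_; _,_; proj₂)
  open import Function using (_∘_)
  open import Relation.Binary.Definitions using (DecidableEquality)
  open import Relation.Nullary using (yes; no; ¬?; contradiction)
  open import Relation.Unary using (Decidable)
  open import Relation.Binary.PropositionalEquality

  length-filter-split : ∀ {A : Set} {P : A → Set} (P? : Decidable P) xs →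
    length xs ≡ length (filter P? xs) + length (filter (¬? ∘ P?) xs)
  length-filter-split P? []       = refl
  length-filter-split P? (x ∷ xs) with P? x
  ... | yes _ = cong suc (length-filter-split P? xs)
  ... | no  _ = trans (cong suc (length-filter-split P? xs)) (sym (+-suc _ _))

  unique⊆⇒length≤ : ∀ {A : Set} → DecidableEquality A → ∀ {xs ys : List A} →
                    Unique xs → All (_∈ ys) xs → length xs ≤ length ys
  unique⊆⇒length≤ _≟_ {[]}    {ys}     _      _          = z≤n
  unique⊆⇒length≤ _≟_ {x ∷ _} {[]}     _      (() ∷ _)
  unique⊆⇒length≤ _≟_ {xs}    {y ∷ ys} xs-unique xs⊆y∷ys = begin
    length xs
      ≡⟨ length-filter-split (_≟ y) xs ⟩
    length (filter (_≟ y) xs) + length (filter (¬? ∘ (_≟ y)) xs)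
      ≤⟨ +-mono-≤ (atMostOne (Unique.filter⁺ (_≟ y) xs-unique)
                             (All.tabulate (proj₂ ∘ ∈-filter⁻ (_≟ y) {xs = xs})))
                  (unique⊆⇒length≤ _≟_ (Unique.filter⁺ (¬? ∘ (_≟ y)) xs-unique)
                                       (All.tabulate others)) ⟩
    1 + length ys ∎
    where
    open ≤-Reasoning
    atMostOne : ∀ {zs} → Unique zs → All (_≡ y) zs → length zs ≤ 1
    atMostOne []                         _                    = z≤n
    atMostOne (_ ∷ [])                   _                    = ≤-refl
    atMostOne ((z≢z′ ∷ _) ∷ _ ∷ _) (z≡y ∷ z′≡y ∷ _) = contradiction (trans z≡y (sym z′≡y)) z≢z′
    others : ∀ {z} → z ∈ filter (¬? ∘ (_≟ y)) xs → z ∈ ys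
    others z∈ with ∈-filter⁻ (¬? ∘ (_≟ y)) z∈
    ... | z∈xs , z≢y with All.lookup xs⊆y∷ys z∈xs
    ...   | here z≡y  = contradiction z≡y z≢y
    ...   | there z∈ys = z∈ys

  length-filter-applyUpTo : ∀ {A : Set} {P : A → Set} (P? : Decidable P) f n →
    length (filter P? (applyUpTo f n)) ≡ ∑< n (λ i → indicator (P? (f i)))
  length-filter-applyUpTo P? f zero = refl
  length-filter-applyUpTo P? f (suc n) with P? (f 0)
  ... | yes _ = cong suc (length-filter-applyUpTo P? (f ∘ suc) n)
  ... | no  _ = length-filter-applyUpTo P? (f ∘ suc) n

  sievedBelow : List ℕ → ℕ → List ℕ
  sievedBelow qs M = filter (sieved? qs) (upTo M)

  sievedBelow-increasing : ∀ qs M → AllPairs _<_ (sievedBelow qs M)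
  sievedBelow-increasing qs M =
    AllPairs.filter⁺ (sieved? qs) (AllPairs.applyUpTo⁺₁ (λ i → i) M (λ i<j _ → i<j))

  ∈-sievedBelow⁻ : ∀ {qs M n} → n ∈ sievedBelow qs M → n < M × Sieved qs n
  ∈-sievedBelow⁻ {qs} n∈ with ∈-filter⁻ (sieved? qs) n∈
  ... | n∈upTo , n-sieved = ∈-upTo⁻ n∈upTo , n-sieved

  length-sievedBelow : ∀ qs → DistinctPrimes qs → ∀ r →
    r * product (map pred qs) ≤ length (sievedBelow qs (r * product qs))
  length-sievedBelow qs distinct r = begin
    r * φ
      ≡⟨ ∑-const r φ ⟨
    ∑< r (λ _ → φ)
      ≤⟨ ∑-mono r (λ j → sieve qs distinct (j * P)) ⟩
    ∑< r (λ j → ∑< P (λ i → indicator (sieved? qs (j * P + i))))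
      ≡⟨ ∑-blocks r P (indicator ∘ sieved? qs) ⟨
    ∑< (r * P) (indicator ∘ sieved? qs)
      ≡⟨ length-filter-applyUpTo (sieved? qs) (λ i → i) (r * P) ⟨
    length (sievedBelow qs (r * P)) ∎
    where
    open ≤-Reasoning
    φ P : ℕ
    φ = product (map pred qs)
    P = product qs

module Spreading where

  open SievedNumbers
  open import Data.Nat
  open import Data.Nat.Properties
  open import Data.Fin as Fin using (Fin; zero; suc)
  open import Data.Vec using (Vec; []; _∷_; lookup)
  open import Data.List using (List; []; _∷_; length; map; filter)
  open import Data.List.Properties using (length-map)
  open import Data.List.Relation.Unary.All as All using (All; []; _∷_)
  open import Data.List.Relation.Unary.Any using (here; there)
  open import Data.List.Relation.Unary.AllPairs as AllPairs using (AllPairs; []; _∷_)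
  import Data.List.Relation.Unary.AllPairs.Properties as AllPairsₚ
  open import Data.List.Membership.Propositional using (_∈_; _∉_)
  open import Data.List.Membership.Propositional.Properties using (∈-filter⁻; ∈-map⁺)
  open import Data.List.Membership.DecPropositional _≟_ using (_∈?_)
  open import Data.Product using (Σ; _×_; _,_; proj₁; proj₂)
  open import Function using (_∘_)
  open import Relation.Nullary using (¬_; ¬?)
  open import Relation.Binary.PropositionalEquality

  Spread : List ℕ → List ℕ → ∀ {n} → Vec ℕ n → Set
  Spread D cs v = (∀ i → lookup v i ∈ cs) ×
                  (∀ i j → i Fin.< j → lookup v i < lookup v j × lookup v j ∸ lookup v i ∉ D)

  -- Greedy selection: take the least element c, discard the at most |D| later
  -- elements of the form c + d with d ∈ D, and continue with the rest.
  -- Each choice costs at most |D| + 1 elements, which gives the length bound.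
  spread : ∀ k D cs → AllPairs _<_ cs → k * suc (length D) < length cs →
           Σ (Vec ℕ (suc k)) (Spread D cs)
  spread zero    D (c ∷ cs) _ _ = c ∷ [] , (λ { zero → here refl }) , λ { zero zero () }
  spread (suc k) D (c ∷ cs) (c<cs ∷ cs-increasing) long =
    c ∷ v , member , separated
    where
    forbidden : List ℕ
    forbidden = map (c +_) D
    far : List ℕ
    far = filter (¬? ∘ (_∈? forbidden)) cs
    near-few : length (filter (_∈? forbidden) cs) ≤ length D
    near-few = begin
      length (filter (_∈? forbidden) cs)
        ≤⟨ unique⊆⇒length≤ _≟_
             (AllPairsₚ.filter⁺ (_∈? forbidden) (AllPairs.map <⇒≢ cs-increasing))
             (All.tabulate (λ y∈ → proj₂ (∈-filter⁻ (_∈? forbidden) {xs = cs} y∈))) ⟩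
      length forbidden
        ≡⟨ length-map (c +_) D ⟩
      length D ∎
      where open ≤-Reasoning
    far-long : k * suc (length D) < length far
    far-long = +-cancelˡ-≤ (length D) _ _ (begin
      length D + suc (k * suc (length D))       ≡⟨ +-suc (length D) _ ⟩
      suc (length D) + k * suc (length D)       ≤⟨ s≤s⁻¹ long ⟩
      length cs                                 ≡⟨ length-filter-split (_∈? forbidden) cs ⟩
      length (filter (_∈? forbidden) cs) + length far ≤⟨ +-monoˡ-≤ (length far) near-few ⟩
      length D + length far                     ∎)
      where open ≤-Reasoning
    rest : Σ (Vec ℕ (suc k)) (Spread D far)
    rest = spread k D far (AllPairsₚ.filter⁺ _ cs-increasing) far-long
    v : Vec ℕ (suc k)
    v = proj₁ rest
    member : ∀ i → lookup (c ∷ v) i ∈ c ∷ cs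
    member zero    = here refl
    member (suc i) = there (proj₁ (∈-filter⁻ _ (proj₁ (proj₂ rest) i)))
    separated : ∀ i j → i Fin.< j →
      lookup (c ∷ v) i < lookup (c ∷ v) j × lookup (c ∷ v) j ∸ lookup (c ∷ v) i ∉ D
    separated zero (suc j) _ with ∈-filter⁻ _ (proj₁ (proj₂ rest) j)
    ... | y∈cs , y-far = c<y , y∸c∉D
      where
      c<y : c < lookup v j
      c<y = All.lookup c<cs y∈cs
      y∸c∉D : lookup v j ∸ c ∉ D
      y∸c∉D y∸c∈D = y-far (subst (_∈ forbidden) (m+[n∸m]≡n (<⇒≤ c<y)) (∈-map⁺ (c +_) y∸c∈D))
    separated (suc i) (suc j) (s≤s i<j) = proj₂ (proj₂ rest) i j i<j

module Admissibility where

  open import Defs using (Admissible)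
  open Sieve
  open import Data.Nat as ℕ using (ℕ; suc; _≤_; _<_; _∸_)
  import Data.Nat.Properties as ℕ
  import Data.Nat.Divisibility as ℕ
  open import Data.Nat.Primality using (Prime)
  open import Data.Integer as ℤ using (ℤ; +_; _-_; _⊖_)
  import Data.Integer.Properties as ℤ
  open import Data.Integer.Divisibility using (_∣_)
  import Data.Integer.Divisibility.Signed as Signed
  open import Data.Integer.Tactic.RingSolver using (solve-∀)
  open import Data.Fin as Fin using (Fin; toℕ)
  import Data.Fin.Properties as Fin
  open import Data.List.Relation.Unary.All as All using (All)
  open import Data.List.Membership.Propositional using (_∈_)
  open import Data.Product using (Σ; _,_; proj₁; proj₂)
  open import Relation.Nullary using (¬_; yes; no)
  open import Data.Empty using (⊥-elim)
  open import Relation.Binary.PropositionalEquality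

  distinct-residues : ∀ {p r s} (x : ℤ) → r < s → s < p →
                      (+ p) ∣ (x - + r) → ¬ (+ p) ∣ (x - + s)
  distinct-residues {p} {r} {s} x r<s s<p p∣x-r p∣x-s =
    ℕ.<⇒≱ (ℕ.≤-<-trans (ℕ.m∸n≤m s r) s<p) (ℕ.∣⇒≤ {{ℕ.>-nonZero (ℕ.m<n⇒0<n∸m r<s)}} p∣s∸r)
    where
    gap : ∀ (x r s : ℤ) → (x - r) - (x - s) ≡ s - r
    gap = solve-∀
    p∣s∸r : p ℕ.∣ s ∸ r
    p∣s∸r = subst (p ℕ.∣_)
      (cong ℤ.∣_∣ (trans (gap x (+ r) (+ s)) (trans (ℤ.m-n≡m⊖n s r) (ℤ.⊖-≥ (ℕ.<⇒≤ r<s)))))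
      (Signed.∣⇒∣ᵤ {+ p} p∣difference)
      where
      p∣difference : (+ p) Signed.∣ (x - + r) - (x - + s)
      p∣difference = Signed.∣m∣n⇒∣m-n (Signed.∣ᵤ⇒∣ {+ p} {x - + r} p∣x-r) (Signed.∣ᵤ⇒∣ {+ p} {x - + s} p∣x-s)

  -- Pigeonhole: n integers leave some residue class free modulo any p > n,
  -- because two of the n + 1 classes 0, …, n would otherwise share a witness.
  missed-class : ∀ {n} (x : Fin n → ℤ) p → n < p →
                 Σ ℤ (λ r → (i : Fin n) → ¬ (+ p) ∣ (x i - r))
  missed-class {n} x p n<p
    with Fin.all? (λ r → Fin.any? (λ i → p ℕ.∣? ℤ.∣ x i - + toℕ r ∣))
  ... | no ¬all-hit with Fin.¬∀⟶∃¬ (suc n) _ (λ r → Fin.any? (λ i → p ℕ.∣? ℤ.∣ x i - + toℕ r ∣)) ¬all-hit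
  ...   | r , r-free = + toℕ r , λ i p∣ → r-free (i , p∣)
  missed-class {n} x p n<p | yes all-hit
    with Fin.pigeonhole ℕ.≤-refl (λ r → proj₁ (all-hit r))
  ... | r , s , r<s , same-witness = ⊥-elim
    (distinct-residues (x i) r<s (ℕ.≤-<-trans (ℕ.≤-pred (Fin.toℕ<n s)) n<p)
      (proj₂ (all-hit r)) (subst (λ j → (+ p) ∣ (x j - + toℕ s)) (sym same-witness) (proj₂ (all-hit s))))
    where
    i : Fin n
    i = proj₁ (all-hit r)

  -- k + 1 naturals none of which is divisible by a prime ≤ k + 1 form an
  -- admissible family: such primes miss the class 0, larger ones some class.
  sieved⇒admissible : ∀ {k qs} → (∀ p → p ≤ suc k → Prime p → p ∈ qs) →
    (v : Fin (suc k) → ℕ) → (∀ i → Sieved qs (v i)) → Admissible (λ i → + v i)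
  sieved⇒admissible {k} small-primes v sieved p p-prime with p ℕ.≤? suc k
  ... | yes p≤k+1 = + 0 , λ i p∣vᵢ → All.lookup (sieved i) (small-primes p p≤k+1 p-prime)
                                        (subst (p ℕ.∣_) (ℕ.+-identityʳ (v i)) p∣vᵢ)
  ... | no  p≰k+1 = missed-class (λ i → + v i) p (ℕ.≰⇒> p≰k+1)

module Harvesting where

  open import Defs using (Plausible2; Admissible)
  open FiniteSums
  open Sieve
  open SievedNumbers
  open Spreading
  open Admissibility
  open import Data.Nat as ℕ using (ℕ; zero; suc; _≤_; _<_; _+_; _∸_; _*_; z≤n)
  import Data.Nat.Properties as ℕ
  open import Data.Nat.Primality using (Prime)
  open import Data.Nat.ListAction using (sum; product)
  open import Data.Nat.ListAction.Properties using (sum-++)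
  open import Data.Integer as ℤ using (ℤ; +_; _-_)
  import Data.Integer.Properties as ℤ
  open import Data.Integer.Tactic.RingSolver using (solve-∀)
  open import Data.Fin as Fin using (Fin)
  import Data.Fin.Properties as Fin
  open import Data.Vec using (Vec; lookup)
  open import Data.List using (List; []; _∷_; length; map; _++_)
  open import Data.List.Properties using (length-++; map-++)
  open import Data.List.Relation.Unary.All using (All; []; _∷_)
  open import Data.List.Relation.Unary.All.Properties using (¬Any⇒All¬)
  open import Data.List.Relation.Unary.Unique.Propositional using (Unique; []; _∷_)
  open import Data.List.Membership.Propositional using (_∈_; _∉_)
  open import Data.Product using (Σ; _×_; _,_; proj₁; proj₂)
  open import Function.Definitions using (Injective)
  open import Relation.Binary.Definitions using (tri<; tri≈; tri>)
  open import Relation.Nullary using (contradiction)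
  open import Relation.Binary.PropositionalEquality

  FullDifference : (ℤ × ℤ → Set) → ℕ → Set
  FullDifference A d = ∀ h → A (h , h ℤ.+ + d)

  pair⇒full-difference : ∀ (A : ℤ × ℤ → Set) →
    (∀ h₁ h₂ t → A (h₁ , h₂) → A (h₁ ℤ.+ t , h₂ ℤ.+ t)) →
    ∀ {a b} → a < b → A (+ a , + b) → FullDifference A (b ∸ a)
  pair⇒full-difference A translate {a} {b} a<b Aab h =
    subst₂ (λ u w → A (u , w)) (cancel (+ a) h) (trans (shift (+ a) (+ b) h) (cong (λ t → h ℤ.+ t) b-a))
      (translate (+ a) (+ b) (h - + a) Aab)
    where
    cancel : ∀ a h → a ℤ.+ (h - a) ≡ h
    cancel = solve-∀
    shift : ∀ a b h → b ℤ.+ (h - a) ≡ h ℤ.+ (b - a)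
    shift = solve-∀
    b-a : + b - + a ≡ + (b ∸ a)
    b-a = trans (ℤ.m-n≡m⊖n b a) (ℤ.⊖-≥ (ℕ.<⇒≤ a<b))

  -- The number of pairs (h, h + d) with both entries in a window of W
  -- consecutive integers, summed over d ∈ D.
  weight : ℕ → List ℕ → ℕ
  weight W D = sum (map (W ∸_) D)

  weight-++ : ∀ W E D → weight W (E ++ D) ≡ weight W E + weight W D
  weight-++ W E D = trans (cong sum (map-++ (W ∸_) E D)) (sum-++ (map (W ∸_) E) (map (W ∸_) D))

  weight-below : ∀ W M {E} → All (_< M) E → length E * (W ∸ M) ≤ weight W E
  weight-below W M []           = z≤n
  weight-below W M (d<M ∷ E<M) =
    ℕ.+-mono-≤ (ℕ.∸-monoʳ-≤ W (ℕ.<⇒≤ d<M)) (weight-below W M E<M)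

  module Differences (k : ℕ) (qs : List ℕ) (small-primes : ∀ p → p ≤ suc k → Prime p → p ∈ qs)
                     (A : ℤ × ℤ → Set) (plausible : Plausible2 (suc k) A) where

    translate : ∀ h₁ h₂ t → A (h₁ , h₂) → A (h₁ ℤ.+ t , h₂ ℤ.+ t)
    translate = proj₁ plausible
    symmetric : ∀ h₁ h₂ → A (h₁ , h₂) → A (h₂ , h₁)
    symmetric = proj₁ (proj₂ plausible)
    covering : (x : Fin (suc k) → ℤ) → Injective _≡_ _≡_ x → Admissible x →
               Σ (Fin (suc k)) λ i → Σ (Fin (suc k)) λ j → i ≢ j × A (x i , x j)
    covering = proj₂ (proj₂ plausible)

    NewDifference : List ℕ → ℕ → Set
    NewDifference D M = Σ ℕ λ d → FullDifference A d × 0 < d × d < M × d ∉ D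

    -- Given more than k·(|D| + 1) sieved numbers below M, there is a new full
    -- difference below M: spread out k + 1 of them avoiding the differences D;
    -- they are admissible, so plausibility puts one of their pairs into A.
    module Selection (D : List ℕ) (M : ℕ) (long : k * suc (length D) < length (sievedBelow qs M)) where
      selection : Σ (Vec ℕ (suc k)) (Spread D (sievedBelow qs M))
      selection = spread k D (sievedBelow qs M) (sievedBelow-increasing qs M) long
      v : Fin (suc k) → ℕ
      v = lookup (proj₁ selection)
      member : ∀ i → v i ∈ sievedBelow qs M
      member = proj₁ (proj₂ selection)
      separated : ∀ i j → i Fin.< j → v i < v j × v j ∸ v i ∉ D
      separated = proj₂ (proj₂ selection)
      x : Fin (suc k) → ℤ
      x i = + v i
      x-injective : Injective _≡_ _≡_ x
      x-injective {i} {j} xᵢ≡xⱼ with Fin.<-cmp i j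
      ... | tri< i<j _ _ = contradiction (ℤ.+-injective xᵢ≡xⱼ) (ℕ.<⇒≢ (proj₁ (separated i j i<j)))
      ... | tri≈ _ i≡j _ = i≡j
      ... | tri> _ _ j<i = contradiction (sym (ℤ.+-injective xᵢ≡xⱼ)) (ℕ.<⇒≢ (proj₁ (separated j i j<i)))
      x-admissible : Admissible x
      x-admissible = sieved⇒admissible small-primes v
                       (λ i → proj₂ (∈-sievedBelow⁻ {M = M} (member i)))
      from-pair : ∀ {i j} → i Fin.< j → A (x i , x j) → NewDifference D M
      from-pair {i} {j} i<j Aᵢⱼ with separated i j i<j
      ... | vᵢ<vⱼ , gap∉D = v j ∸ v i , pair⇒full-difference A translate vᵢ<vⱼ Aᵢⱼ ,
                             ℕ.m<n⇒0<n∸m vᵢ<vⱼ , ℕ.≤-<-trans (ℕ.m∸n≤m (v j) (v i)) vⱼ<M , gap∉D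
        where
        vⱼ<M : v j < M
        vⱼ<M = proj₁ (∈-sievedBelow⁻ {M = M} (member j))
      new-difference : NewDifference D M
      new-difference with covering x x-injective x-admissible
      ... | i , j , i≢j , Aᵢⱼ with Fin.<-cmp i j
      ...   | tri< i<j _ _ = from-pair i<j Aᵢⱼ
      ...   | tri≈ _ i≡j _ = contradiction i≡j i≢j
      ...   | tri> _ _ j<i = from-pair j<i (symmetric _ _ Aᵢⱼ)

    open Selection using (new-difference)

    FullDifferences : List ℕ → Set
    FullDifferences D = Unique D × All (λ d → FullDifference A d × 0 < d) D

    extend : ∀ s D M → FullDifferences D → k * (s + length D) < length (sievedBelow qs M) →
      Σ (List ℕ) λ E → length E ≡ s × All (_< M) E × FullDifferences (E ++ D)
    extend zero    D M good _ = [] , refl , [] , good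
    extend (suc s) D M good long
      with extend s D M good (ℕ.≤-<-trans (ℕ.*-monoʳ-≤ k (ℕ.n≤1+n _)) long)
    ... | E , refl , E<M , E++D-unique , E++D-full
      with new-difference (E ++ D) M (subst (λ n → k * suc n < _) (sym (length-++ E)) long)
    ...   | d , d-full , d>0 , d<M , d∉E++D =
            d ∷ E , refl , d<M ∷ E<M , ¬Any⇒All¬ _ d∉E++D ∷ E++D-unique , (d-full , d>0) ∷ E++D-full

    -- Round j adds β differences below (j + 2)·P, where P = ∏ qs: by the sieve
    -- estimate the (j + 2)·∏ (q − 1) ≥ (j + 2)·k·β sieved numbers below (j + 2)·P
    -- leave room for them.
    module Rounds (distinct : DistinctPrimes qs) (β : ℕ) (kβ≤φ : k * β ≤ product (map ℕ.pred qs)) where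

      P φ : ℕ
      P = product qs
      φ = product (map ℕ.pred qs)

      room : ∀ R (D : List ℕ) → length D ≡ R * β → k * (β + length D) < length (sievedBelow qs ((2 + R) * P))
      room R D |D|≡Rβ = begin-strict
        k * (β + length D)     ≡⟨ cong (λ n → k * (β + n)) |D|≡Rβ ⟩
        k * (suc R * β)        ≡⟨ regroup k R β ⟩
        suc R * (k * β)        ≤⟨ ℕ.*-monoʳ-≤ (suc R) kβ≤φ ⟩
        suc R * φ              <⟨ ℕ.m<n+m (suc R * φ) (totient-positive distinct) ⟩
        (2 + R) * φ            ≤⟨ length-sievedBelow qs distinct (2 + R) ⟩
        length (sievedBelow qs ((2 + R) * P)) ∎
        where
        open ℕ.≤-Reasoning
        regroup : ∀ k R β → k * (suc R * β) ≡ suc R * (k * β)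
        regroup = Nat.solve-∀
          where import Data.Nat.Tactic.RingSolver as Nat

      harvest : ∀ R → Σ (List ℕ) λ D → length D ≡ R * β × FullDifferences D ×
                  (∀ W → β * ∑< R (λ j → W ∸ (2 + j) * P) ≤ weight W D)
      harvest zero = [] , refl , ([] , []) , λ W → ℕ.≤-reflexive (ℕ.*-zeroʳ β)
      harvest (suc R) with harvest R
      ... | D , |D|≡Rβ , D-good , D-weight with extend β D ((2 + R) * P) D-good (room R D |D|≡Rβ)
      ...   | E , |E|≡β , E<M , E++D-good =
              E ++ D , trans (length-++ E {D}) (cong₂ _+_ |E|≡β |D|≡Rβ) , E++D-good , weight-bound
        where
        weight-bound : ∀ W → β * ∑< (suc R) (λ j → W ∸ (2 + j) * P) ≤ weight W (E ++ D)
        weight-bound W = begin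
          β * ∑< (suc R) f                  ≡⟨ cong (β *_) (∑-last R f) ⟩
          β * (∑< R f + f R)                ≡⟨ ℕ.*-distribˡ-+ β (∑< R f) (f R) ⟩
          β * ∑< R f + β * f R              ≤⟨ ℕ.+-mono-≤ (D-weight W) E-weight ⟩
          weight W D + weight W E           ≡⟨ ℕ.+-comm (weight W D) (weight W E) ⟩
          weight W E + weight W D           ≡⟨ weight-++ W E D ⟨
          weight W (E ++ D)                 ∎
          where
          open ℕ.≤-Reasoning
          f : ℕ → ℕ
          f j = W ∸ (2 + j) * P
          E-weight : β * f R ≤ weight W E
          E-weight = subst (λ n → n * f R ≤ weight W E) |E|≡β (weight-below W _ E<M)

module SquarePoints where

  open import Defs using (InBox)
  open Harvesting using (weight; FullDifference)
  open import Data.Nat as ℕ using (ℕ; suc; _≤_; _<_; _∸_; z≤n)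
  import Data.Nat.Properties as ℕ
  open import Data.Integer as ℤ using (ℤ; +_; -_; _-_; +≤+)
  import Data.Integer.Properties as ℤ
  open import Data.Integer.Tactic.RingSolver using (solve-∀)
  open import Data.List using (List; []; _∷_; length; map; upTo; _++_)
  open import Data.List.Properties using (length-map; length-++; length-upTo)
  open import Data.List.Relation.Unary.All as All using (All; []; _∷_)
  import Data.List.Relation.Unary.All.Properties as All
  open import Data.List.Relation.Unary.Unique.Propositional using (Unique; []; _∷_)
  import Data.List.Relation.Unary.Unique.Propositional.Properties as Unique
  open import Data.List.Membership.Propositional using (_∈_; _∉_)
  open import Data.List.Relation.Unary.Any using (here; there)
  open import Data.List.Membership.Propositional.Properties using (∈-map⁻; ∈-++⁻; ∈-upTo⁻)
  open import Data.Product using (_×_; _,_; proj₁; proj₂; swap)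
  open import Data.Sum using (inj₁; inj₂)
  open import Relation.Nullary using (¬_)
  open import Relation.Binary.PropositionalEquality

  at : ℕ → ℕ → ℤ
  at N k = + k - + N

  at-injective : ∀ N {k l} → at N k ≡ at N l → k ≡ l
  at-injective N {k} {l} eq = ℤ.+-injective (begin
    + k                ≡⟨ cancel (+ k) (+ N) ⟨
    (+ k - + N) ℤ.+ + N ≡⟨ cong (ℤ._+ + N) eq ⟩
    (+ l - + N) ℤ.+ + N ≡⟨ cancel (+ l) (+ N) ⟩
    + l                ∎)
    where
    open ≡-Reasoning
    cancel : ∀ k n → (k - n) ℤ.+ n ≡ k
    cancel = solve-∀

  at-inBox : ∀ N {k} → k ≤ 2 ℕ.* N → InBox N (at N k)
  at-inBox N {k} k≤2N =
    subst (ℤ._≤ at N k) (ℤ.+-identityˡ (- + N)) (ℤ.+-monoˡ-≤ (- + N) (+≤+ z≤n)) ,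
    subst (at N k ℤ.≤_) (cancel (+ N)) (ℤ.+-monoˡ-≤ (- + N) (+≤+ k≤N+N))
    where
    k≤N+N : k ≤ N ℕ.+ N
    k≤N+N = subst (k ≤_) (cong (N ℕ.+_) (ℕ.+-identityʳ N)) k≤2N
    cancel : ∀ n → (n ℤ.+ n) - n ≡ n
    cancel = solve-∀

  <∸⇒+< : ∀ k d W → k < W ∸ d → k ℕ.+ d < W
  <∸⇒+< k ℕ.zero  W       k<W = subst (_< W) (sym (ℕ.+-identityʳ k)) k<W
  <∸⇒+< k (suc d) (suc W) k<W = subst (_< suc W) (sym (ℕ.+-suc k d)) (ℕ.s≤s (<∸⇒+< k d W k<W))

  diagonal : ℕ → ℕ → List (ℤ × ℤ)
  diagonal N d = map (λ k → at N k , at N k ℤ.+ + d) (upTo (suc (2 ℕ.* N) ∸ d))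

  points : ℕ → List ℕ → List (ℤ × ℤ)
  points N []      = []
  points N (d ∷ D) = (diagonal N d ++ map swap (diagonal N d)) ++ points N D

  length-points : ∀ N D → length (points N D) ≡ 2 ℕ.* weight (suc (2 ℕ.* N)) D
  length-points N []      = refl
  length-points N (d ∷ D) = begin
    length ((diagonal N d ++ map swap (diagonal N d)) ++ points N D)
      ≡⟨ length-++ (diagonal N d ++ _) ⟩
    length (diagonal N d ++ map swap (diagonal N d)) ℕ.+ length (points N D)
      ≡⟨ cong₂ ℕ._+_ length-block (length-points N D) ⟩
    ((W ∸ d) ℕ.+ (W ∸ d)) ℕ.+ 2 ℕ.* weight W D
      ≡⟨ double (W ∸ d) (weight W D) ⟩
    2 ℕ.* weight W (d ∷ D) ∎
    where
    open ≡-Reasoning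
    W : ℕ
    W = suc (2 ℕ.* N)
    length-diagonal : length (diagonal N d) ≡ W ∸ d
    length-diagonal = trans (length-map _ (upTo (W ∸ d))) (length-upTo (W ∸ d))
    length-block : length (diagonal N d ++ map swap (diagonal N d)) ≡ (W ∸ d) ℕ.+ (W ∸ d)
    length-block = trans (length-++ (diagonal N d))
      (cong₂ ℕ._+_ length-diagonal (trans (length-map swap (diagonal N d)) length-diagonal))
    double : ∀ a w → (a ℕ.+ a) ℕ.+ 2 ℕ.* w ≡ 2 ℕ.* (a ℕ.+ w)
    double = Nat.solve-∀
      where import Data.Nat.Tactic.RingSolver as Nat

  InSquare : (ℤ × ℤ → Set) → ℕ → ℤ × ℤ → Set
  InSquare A N z = A z × InBox N (proj₁ z) × InBox N (proj₂ z)

  diagonal-inSquare : ∀ (A : ℤ × ℤ → Set) N {d} → FullDifference A d → All (InSquare A N) (diagonal N d)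
  diagonal-inSquare A N {d} d-full = All.map⁺ (All.tabulate (λ k∈ → inside (∈-upTo⁻ k∈)))
    where
    shift : ∀ k n d → (k - n) ℤ.+ d ≡ (k ℤ.+ d) - n
    shift = solve-∀
    inside : ∀ {k} → k < suc (2 ℕ.* N) ∸ d → InSquare A N (at N k , at N k ℤ.+ + d)
    inside {k} k<W∸d = d-full (at N k) ,
                       at-inBox N (ℕ.≤-trans (ℕ.m≤m+n k d) k+d≤2N) ,
                       subst (InBox N) (sym (shift (+ k) (+ N) (+ d))) (at-inBox N k+d≤2N)
      where
      k+d≤2N : k ℕ.+ d ≤ 2 ℕ.* N
      k+d≤2N = ℕ.s≤s⁻¹ (<∸⇒+< k d _ k<W∸d)

  points-inSquare : ∀ (A : ℤ × ℤ → Set) → (∀ h₁ h₂ → A (h₁ , h₂) → A (h₂ , h₁)) →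
    ∀ N {D} → All (FullDifference A) D → All (InSquare A N) (points N D)
  points-inSquare A symmetric N []               = []
  points-inSquare A symmetric N {d ∷ D} (d-full ∷ D-full) =
    All.++⁺ (All.++⁺ on-diagonal (All.map⁺ (All.map mirror on-diagonal)))
            (points-inSquare A symmetric N D-full)
    where
    on-diagonal : All (InSquare A N) (diagonal N d)
    on-diagonal = diagonal-inSquare A N d-full
    mirror : ∀ {z} → InSquare A N z → InSquare A N (swap z)
    mirror (Az , u-in , v-in) = symmetric _ _ Az , v-in , u-in

  -- The signed difference v − u of a pair (u, v) tells the diagonals apart.
  gap : ℤ × ℤ → ℤ
  gap (u , v) = v - u

  ∈-diagonal⇒gap : ∀ {N d z} → z ∈ diagonal N d → gap z ≡ + d
  ∈-diagonal⇒gap {N} {d} z∈ with ∈-map⁻ _ z∈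
  ... | k , _ , refl = cancel (at N k) (+ d)
    where
    cancel : ∀ h d → (h ℤ.+ d) - h ≡ d
    cancel = solve-∀

  ∈-mirror⇒gap : ∀ {N d z} → z ∈ map swap (diagonal N d) → gap z ≡ - + d
  ∈-mirror⇒gap {N} z∈ with ∈-map⁻ swap z∈
  ... | (u , v) , uv∈ , refl = trans (flip u v) (cong -_ (∈-diagonal⇒gap {N} uv∈))
    where
    flip : ∀ u v → u - v ≡ - (v - u)
    flip = solve-∀

  ∈-block⇒size : ∀ {N d z} → z ∈ diagonal N d ++ map swap (diagonal N d) → ℤ.∣ gap z ∣ ≡ d
  ∈-block⇒size {N} {d} z∈ with ∈-++⁻ (diagonal N d) z∈
  ... | inj₁ z∈diagonal = cong ℤ.∣_∣ (∈-diagonal⇒gap {N} z∈diagonal)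
  ... | inj₂ z∈mirror   = trans (cong ℤ.∣_∣ (∈-mirror⇒gap {N} z∈mirror)) (ℤ.∣-i∣≡∣i∣ (+ d))

  ∈-points⇒size : ∀ {N D z} → z ∈ points N D → ℤ.∣ gap z ∣ ∈ D
  ∈-points⇒size {N} {d ∷ D} z∈ with ∈-++⁻ (diagonal N d ++ map swap (diagonal N d)) z∈
  ... | inj₁ z∈block = here (∈-block⇒size {N} z∈block)
  ... | inj₂ z∈rest  = there (∈-points⇒size z∈rest)

  points-unique : ∀ N {D} → Unique D → All (0 <_) D → Unique (points N D)
  points-unique N {[]}    []                 []          = []
  points-unique N {d ∷ D} (d∉D ∷ D-unique) (d>0 ∷ D>0) =
    Unique.++⁺ (Unique.++⁺ diagonal-unique (Unique.map⁺ (cong swap) diagonal-unique) sides-apart)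
               (points-unique N D-unique D>0) blocks-apart
    where
    diagonal-unique : Unique (diagonal N d)
    diagonal-unique = Unique.map⁺ (λ eq → at-injective N (cong proj₁ eq)) (Unique.upTo⁺ _)
    sides-apart : ∀ {z} → ¬ (z ∈ diagonal N d × z ∈ map swap (diagonal N d))
    sides-apart (z∈diagonal , z∈mirror) =
      +d≢-d d>0 (trans (sym (∈-diagonal⇒gap {N} z∈diagonal)) (∈-mirror⇒gap {N} z∈mirror))
      where
      +d≢-d : ∀ {d} → 0 < d → + d ≢ - + d
      +d≢-d {suc _} _ ()
    blocks-apart : ∀ {z} → ¬ (z ∈ diagonal N d ++ map swap (diagonal N d) × z ∈ points N D)
    blocks-apart (z∈block , z∈rest) =
      All.lookup d∉D (subst (_∈ D) (∈-block⇒size {N} z∈block) (∈-points⇒size z∈rest)) refl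

module Arithmetic where

  open FiniteSums
  open import Data.Nat
  open import Data.Nat.Properties
  open import Data.Nat.DivMod using (_/_; _%_; m≡m%n+[m/n]*n; m%n<n)
  open import Data.Nat.Tactic.RingSolver using (solve-∀)
  open import Function using (_∘_)
  open import Relation.Binary.PropositionalEquality

  progression-identity : ∀ P R u →
    2 * P * ∑< R (λ j → (R * P + u) ∸ suc j * P) + u * u + P * (R * P + u)
      ≡ (R * P + u) * (R * P + u) + P * u
  progression-identity P zero    u = base P u
    where
    base : ∀ P u → 2 * P * 0 + u * u + P * (0 + u) ≡ (0 + u) * (0 + u) + P * u
    base = solve-∀
  progression-identity P (suc R) u = begin
    2 * P * ∑< (suc R) f + u * u + P * (P + R * P + u)
      ≡⟨ cong₂ (λ s w → 2 * P * s + u * u + P * w) sum-shift (+-assoc P (R * P) u) ⟩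
    2 * P * (V + S) + u * u + P * (P + V)
      ≡⟨ regroup P V S u ⟩
    (2 * P * S + u * u + P * V) + (2 * P * V + P * P)
      ≡⟨ cong (_+ (2 * P * V + P * P)) (progression-identity P R u) ⟩
    (V * V + P * u) + (2 * P * V + P * P)
      ≡⟨ complete P V u ⟩
    (P + V) * (P + V) + P * u
      ≡⟨ cong (λ w → w * w + P * u) (+-assoc P (R * P) u) ⟨
    (P + R * P + u) * (P + R * P + u) + P * u ∎
    where
    open ≡-Reasoning
    V S : ℕ
    V = R * P + u
    S = ∑< R (λ j → V ∸ suc j * P)
    f : ℕ → ℕ
    f j = (P + R * P + u) ∸ suc j * P
    -- The first term is V, the remaining ones are those of the sum for R.
    shifted : ∀ j → f j ≡ V ∸ j * P
    shifted j = trans (cong (_∸ (P + j * P)) (+-assoc P (R * P) u)) ([m+n]∸[m+o]≡n∸o P V (j * P))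
    sum-shift : ∑< (suc R) f ≡ V + S
    sum-shift = cong₂ _+_ (shifted 0) (∑-cong R (shifted ∘ suc))
    regroup : ∀ P V S u → 2 * P * (V + S) + u * u + P * (P + V)
                          ≡ (2 * P * S + u * u + P * V) + (2 * P * V + P * P)
    regroup = solve-∀
    complete : ∀ P V u → (V * V + P * u) + (2 * P * V + P * P) ≡ (P + V) * (P + V) + P * u
    complete = solve-∀

  progression-bound : ∀ P V .{{_ : NonZero P}} →
    V * V ≤ 2 * P * ∑< (V / P) (λ j → V ∸ suc j * P) + P * V
  progression-bound P V = +-cancelʳ-≤ (P * u) _ _ (begin
    V * V + P * u                  ≡⟨ cong (λ w → w * w + P * u) V≡ ⟩
    V′ * V′ + P * u                ≡⟨ progression-identity P R u ⟨
    2 * P * S′ + u * u + P * V′    ≤⟨ +-monoˡ-≤ (P * V′) (+-monoʳ-≤ (2 * P * S′) (*-monoˡ-≤ u u≤P)) ⟩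
    2 * P * S′ + P * u + P * V′    ≡⟨ +-right-comm (2 * P * S′) (P * u) (P * V′) ⟩
    2 * P * S′ + P * V′ + P * u    ≡⟨ cong (λ w → 2 * P * ∑< R (λ j → w ∸ suc j * P) + P * w + P * u) V≡ ⟨
    2 * P * S + P * V + P * u      ∎)
    where
    open ≤-Reasoning
    R u V′ S S′ : ℕ
    R = V / P
    u = V % P
    V′ = R * P + u
    V≡ : V ≡ V′
    V≡ = trans (m≡m%n+[m/n]*n V P) (+-comm u (R * P))
    u≤P : u ≤ P
    u≤P = <⇒≤ (m%n<n V P)
    S = ∑< R (λ j → V ∸ suc j * P)
    S′ = ∑< R (λ j → V′ ∸ suc j * P)
    +-right-comm : ∀ a b c → a + b + c ≡ a + c + b
    +-right-comm = solve-∀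

  -- The final estimate in whole numbers: if the differences contribute weight
  -- w ≥ β·S, where V² ≤ 2P·S + P·V and V ≤ X ≤ P + V, then
  -- β·X² ≤ P·(2w + 3β·X), i.e. 2w/X² ≥ β/P − 3β/X.
  density-estimate : ∀ β P X V S w → V * V ≤ 2 * P * S + P * V → β * S ≤ w →
                     X ≤ P + V → V ≤ X → β * (X * X) ≤ P * (2 * w + 3 * (β * X))
  density-estimate β P X V S w V²≤ βS≤w X≤P+V V≤X = begin
    β * (X * X)                             ≤⟨ *-monoʳ-≤ β (*-monoʳ-≤ X X≤P+V) ⟩
    β * (X * (P + V))                       ≡⟨ expand₁ β X P V ⟩
    β * P * X + β * (X * V)                 ≤⟨ +-monoʳ-≤ (β * P * X) (*-monoʳ-≤ β (*-monoˡ-≤ V X≤P+V)) ⟩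
    β * P * X + β * ((P + V) * V)           ≡⟨ expand₂ β X P V ⟩
    β * P * X + β * P * V + β * (V * V)     ≤⟨ +-monoʳ-≤ (β * P * X + β * P * V) (*-monoʳ-≤ β V²≤) ⟩
    β * P * X + β * P * V + β * (2 * P * S + P * V)
                                            ≡⟨ expand₃ β X P V S ⟩
    P * (2 * (β * S)) + (β * P * X + 2 * (β * P * V))
                                            ≤⟨ +-mono-≤ (*-monoʳ-≤ P (*-monoʳ-≤ 2 βS≤w))
                                                 (+-monoʳ-≤ (β * P * X) (*-monoʳ-≤ 2 (*-monoʳ-≤ (β * P) V≤X))) ⟩
    P * (2 * w) + (β * P * X + 2 * (β * P * X))
                                            ≡⟨ collect β X P w ⟩
    P * (2 * w + 3 * (β * X))               ∎
    where
    open ≤-Reasoning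
    expand₁ : ∀ β X P V → β * (X * (P + V)) ≡ β * P * X + β * (X * V)
    expand₁ = solve-∀
    expand₂ : ∀ β X P V → β * P * X + β * ((P + V) * V) ≡ β * P * X + β * P * V + β * (V * V)
    expand₂ = solve-∀
    expand₃ : ∀ β X P V S → β * P * X + β * P * V + β * (2 * P * S + P * V)
                            ≡ P * (2 * (β * S)) + (β * P * X + 2 * (β * P * V))
    expand₃ = solve-∀
    collect : ∀ β X P w → P * (2 * w) + (β * P * X + 2 * (β * P * X)) ≡ P * (2 * w + 3 * (β * X))
    collect = solve-∀

module RationalEstimates where

  open import Data.Nat as ℕ using (ℕ; suc; NonZero)
  import Data.Nat.Properties as ℕ
  open import Data.Integer as ℤ using (ℤ; +_)
  import Data.Integer.Properties as ℤ
  open import Data.Rational as ℚ using (ℚ; _/_; toℚᵘ; _≤_; _*_; _+_; _-_; -_)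
  open import Data.Rational.Properties
  import Data.Rational.Unnormalised as ℚᵘ
  import Data.Rational.Unnormalised.Properties as ℚᵘ
  open import Relation.Binary.PropositionalEquality
  open import Data.Product using (Σ; _,_)

  ⟦_⟧ : ℕ → ℚ
  ⟦ n ⟧ = + n / 1

  toℚᵘ-/ : ∀ a b .{{_ : NonZero b}} → toℚᵘ (+ a / b) ℚᵘ.≃ ℚᵘ.mkℚᵘ (+ a) (ℕ.pred b)
  toℚᵘ-/ a (suc b) = toℚᵘ-fromℚᵘ (ℚᵘ.mkℚᵘ (+ a) b)

  ⟦⟧-mono-≤ : ∀ {m n} → m ℕ.≤ n → ⟦ m ⟧ ≤ ⟦ n ⟧
  ⟦⟧-mono-≤ {m} {n} m≤n = toℚᵘ-cancel-≤
    (ℚᵘ.≤-respˡ-≃ (ℚᵘ.≃-sym (toℚᵘ-/ m 1)) (ℚᵘ.≤-respʳ-≃ (ℚᵘ.≃-sym (toℚᵘ-/ n 1))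
      (ℚᵘ.*≤* (subst₂ ℤ._≤_ (sym (ℤ.*-identityʳ (+ m))) (sym (ℤ.*-identityʳ (+ n))) (ℤ.+≤+ m≤n)))))

  ⟦⟧-homo-+ : ∀ m n → ⟦ m ⟧ + ⟦ n ⟧ ≡ ⟦ m ℕ.+ n ⟧
  ⟦⟧-homo-+ m n = toℚᵘ-injective (ℚᵘ.≃-trans (toℚᵘ-homo-+ ⟦ m ⟧ ⟦ n ⟧)
    (ℚᵘ.≃-trans (ℚᵘ.+-cong (toℚᵘ-/ m 1) (toℚᵘ-/ n 1))
    (ℚᵘ.≃-trans (ℚᵘ.≃-reflexive (cong (λ k → ℚᵘ.mkℚᵘ k 0) sum)) (ℚᵘ.≃-sym (toℚᵘ-/ (m ℕ.+ n) 1)))))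
    where
    sum : + m ℤ.* + 1 ℤ.+ + n ℤ.* + 1 ≡ + (m ℕ.+ n)
    sum = trans (cong₂ ℤ._+_ (ℤ.*-identityʳ (+ m)) (ℤ.*-identityʳ (+ n))) (sym (ℤ.pos-+ m n))

  ⟦⟧-homo-* : ∀ m n → ⟦ m ⟧ * ⟦ n ⟧ ≡ ⟦ m ℕ.* n ⟧
  ⟦⟧-homo-* m n = toℚᵘ-injective (ℚᵘ.≃-trans (toℚᵘ-homo-* ⟦ m ⟧ ⟦ n ⟧)
    (ℚᵘ.≃-trans (ℚᵘ.*-cong (toℚᵘ-/ m 1) (toℚᵘ-/ n 1))
    (ℚᵘ.≃-trans (ℚᵘ.≃-reflexive (cong (λ k → ℚᵘ.mkℚᵘ k 0) (sym (ℤ.pos-* m n))))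
                (ℚᵘ.≃-sym (toℚᵘ-/ (m ℕ.* n) 1)))))

  /-*-cancel : ∀ a b .{{_ : NonZero b}} → (+ a / b) * ⟦ b ⟧ ≡ ⟦ a ⟧
  /-*-cancel a b@(suc b-1) = toℚᵘ-injective (ℚᵘ.≃-trans (toℚᵘ-homo-* (+ a / b) ⟦ b ⟧)
    (ℚᵘ.≃-trans (ℚᵘ.*-cong (toℚᵘ-/ a b) (toℚᵘ-/ b 1))
    (ℚᵘ.≃-trans (ℚᵘ.*≡* cross) (ℚᵘ.≃-sym (toℚᵘ-/ a 1)))))
    where
    cross : (+ a ℤ.* + b) ℤ.* + 1 ≡ + a ℤ.* + (b ℕ.* 1)
    cross = trans (ℤ.*-identityʳ (+ a ℤ.* + b)) (cong (λ k → + a ℤ.* + k) (sym (ℕ.*-identityʳ b)))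

  ⟦⟧-positive : ∀ n .{{_ : NonZero n}} → ℚ.Positive ⟦ n ⟧
  ⟦⟧-positive (suc n) = normalize-pos (suc n) 1

  *-right-comm : ∀ x y z → x * y * z ≡ x * z * y
  *-right-comm x y z = trans (*-assoc x y z) (trans (cong (x *_) (*-comm y z)) (sym (*-assoc x z y)))

  fraction-≤ : ∀ a b .{{_ : NonZero b}} Y Z → a ℕ.* Y ℕ.≤ b ℕ.* Z → (+ a / b) * ⟦ Y ⟧ ≤ ⟦ Z ⟧
  fraction-≤ a b Y Z aY≤bZ = *-cancelʳ-≤-pos ⟦ b ⟧ {{⟦⟧-positive b}} (begin
    (+ a / b) * ⟦ Y ⟧ * ⟦ b ⟧  ≡⟨ *-right-comm (+ a / b) ⟦ Y ⟧ ⟦ b ⟧ ⟩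
    (+ a / b) * ⟦ b ⟧ * ⟦ Y ⟧  ≡⟨ cong (_* ⟦ Y ⟧) (/-*-cancel a b) ⟩
    ⟦ a ⟧ * ⟦ Y ⟧              ≡⟨ ⟦⟧-homo-* a Y ⟩
    ⟦ a ℕ.* Y ⟧                ≤⟨ ⟦⟧-mono-≤ aY≤bZ ⟩
    ⟦ b ℕ.* Z ⟧                ≡⟨ ⟦⟧-homo-* b Z ⟨
    ⟦ b ⟧ * ⟦ Z ⟧              ≡⟨ *-comm ⟦ b ⟧ ⟦ Z ⟧ ⟩
    ⟦ Z ⟧ * ⟦ b ⟧              ∎)
    where open ≤-Reasoning

  ≤-fraction : ∀ a b .{{_ : NonZero b}} Y Z → b ℕ.* Z ℕ.≤ a ℕ.* Y → ⟦ Z ⟧ ≤ (+ a / b) * ⟦ Y ⟧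
  ≤-fraction a b Y Z bZ≤aY = *-cancelʳ-≤-pos ⟦ b ⟧ {{⟦⟧-positive b}} (begin
    ⟦ Z ⟧ * ⟦ b ⟧              ≡⟨ *-comm ⟦ Z ⟧ ⟦ b ⟧ ⟩
    ⟦ b ⟧ * ⟦ Z ⟧              ≡⟨ ⟦⟧-homo-* b Z ⟩
    ⟦ b ℕ.* Z ⟧                ≤⟨ ⟦⟧-mono-≤ bZ≤aY ⟩
    ⟦ a ℕ.* Y ⟧                ≡⟨ ⟦⟧-homo-* a Y ⟨
    ⟦ a ⟧ * ⟦ Y ⟧              ≡⟨ cong (_* ⟦ Y ⟧) (/-*-cancel a b) ⟨
    (+ a / b) * ⟦ b ⟧ * ⟦ Y ⟧  ≡⟨ *-right-comm (+ a / b) ⟦ b ⟧ ⟦ Y ⟧ ⟩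
    (+ a / b) * ⟦ Y ⟧ * ⟦ b ⟧  ∎)
    where open ≤-Reasoning

  absorb-error : ∀ c ε y l k → c * y ≤ l + k → k ≤ ε * y → (c - ε) * y ≤ l
  absorb-error c ε y l k cy≤l+k k≤εy = begin
    (c - ε) * y         ≡⟨ *-distribʳ-+ y c (- ε) ⟩
    c * y + - ε * y     ≡⟨ cong (λ t → c * y + t) (neg-distribˡ-* ε y) ⟨
    c * y - ε * y       ≤⟨ +-mono-≤ cy≤l+k (neg-antimono-≤ k≤εy) ⟩
    (l + k) - k         ≡⟨ +-assoc l k (- k) ⟩
    l + (k - k)         ≡⟨ cong (λ t → l + t) (+-inverseʳ k) ⟩
    l + ℚ.0ℚ            ≡⟨ +-identityʳ l ⟩
    l                   ∎
    where open ≤-Reasoning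

  positive-fraction : ∀ ε → ℚ.0ℚ ℚ.< ε → Σ ℕ λ n → ε ≡ + suc n / ℚ.↧ₙ ε
  positive-fraction (ℚ.mkℚ (+ suc n) _ _) _ = n , sym (↥p/↧p≡p _)
  positive-fraction (ℚ.mkℚ (+ 0) _ _) (ℚ.*<* (ℤ.+<+ ()))
  positive-fraction (ℚ.mkℚ ℤ.-[1+ _ ] _ _) (ℚ.*<* ())

module Density where

  open import Defs using (LiminfDensity≥; CountAtLeast)
  open SquarePoints using (InSquare)
  open RationalEstimates
  open import Data.Nat as ℕ using (ℕ; suc; NonZero)
  import Data.Nat.Properties as ℕ
  open import Data.Integer using (ℤ; +_)
  open import Data.Rational as ℚ using (_/_)
  import Data.Rational.Properties as ℚ
  open import Data.List using (List; length)
  open import Data.List.Relation.Unary.All using (All)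
  open import Data.List.Relation.Unary.Unique.Propositional using (Unique)
  open import Data.Product using (Σ; _×_; _,_)
  open import Relation.Binary.PropositionalEquality

  SquareCount : (ℤ × ℤ → Set) → ℕ → ℕ → ℕ → Set
  SquareCount A β P N = Σ (List (ℤ × ℤ)) λ L → Unique L × All (InSquare A N) L ×
                          β ℕ.* (X ℕ.* X) ℕ.≤ P ℕ.* (length L ℕ.+ 3 ℕ.* (β ℕ.* X))
    where
    X : ℕ
    X = 2 ℕ.* N

  -- If every square admits such a count, then A has lower density at least
  -- β/P: the error term 3β·2N is at most ε·(2N)² as soon as N ≥ 3β/ε.
  density-from-counts : ∀ (A : ℤ × ℤ → Set) β P .{{_ : NonZero P}} →
    (∀ N → SquareCount A β P N) → LiminfDensity≥ A (+ β / P)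
  density-from-counts A β P counts ε ε>0 with positive-fraction ε ε>0
  ... | n , ε≡n/d = 3 ℕ.* β ℕ.* d , large
    where
    d : ℕ
    d = ℚ.↧ₙ ε
    large : ∀ N → 3 ℕ.* β ℕ.* d ℕ.≤ N → CountAtLeast A N (+ β / P ℚ.- ε)
    large N N₀≤N with counts N
    ... | L , L-unique , L-inside , count = L , L-unique , L-inside ,
          absorb-error (+ β / P) ε ⟦ X ℕ.* X ⟧ ⟦ length L ⟧ ⟦ K ⟧
            (ℚ.≤-trans (fraction-≤ β P (X ℕ.* X) (length L ℕ.+ K) count)
                       (ℚ.≤-reflexive (sym (⟦⟧-homo-+ (length L) K))))
            (subst (λ e → ⟦ K ⟧ ℚ.≤ e ℚ.* ⟦ X ℕ.* X ⟧) (sym ε≡n/d)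
                   (≤-fraction (suc n) d (X ℕ.* X) K error-small))
      where
      X K : ℕ
      X = 2 ℕ.* N
      K = 3 ℕ.* (β ℕ.* X)
      error-small : d ℕ.* K ℕ.≤ suc n ℕ.* (X ℕ.* X)
      error-small = begin
        d ℕ.* (3 ℕ.* (β ℕ.* X))  ≡⟨ regroup d β X ⟩
        3 ℕ.* β ℕ.* d ℕ.* X      ≤⟨ ℕ.*-monoˡ-≤ X (ℕ.≤-trans N₀≤N (ℕ.m≤m+n N (N ℕ.+ 0))) ⟩
        X ℕ.* X                  ≤⟨ ℕ.m≤n*m (X ℕ.* X) (suc n) ⟩
        suc n ℕ.* (X ℕ.* X)      ∎
        where
        open ℕ.≤-Reasoning
        regroup : ∀ d β X → d ℕ.* (3 ℕ.* (β ℕ.* X)) ≡ 3 ℕ.* β ℕ.* d ℕ.* X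
        regroup = Nat.solve-∀
          where import Data.Nat.Tactic.RingSolver as Nat

module GeneralBound where

  open import Defs using (Plausible2; LiminfDensity≥)
  open FiniteSums
  open Sieve
  open Harvesting
  open SquarePoints
  open Arithmetic
  open Density
  open import Data.Nat
  open import Data.Nat.Properties
  open import Data.Nat.DivMod using (_/_)
  open import Data.Nat.Primality using (Prime)
  open import Data.Nat.ListAction using (product)
  open import Data.Integer using (+_)
  import Data.Rational as ℚ
  open import Data.List using (map)
  open import Data.List.Relation.Unary.All as All using (All)
  open import Data.List.Membership.Propositional using (_∈_)
  open import Data.Product using (_,_; proj₁; proj₂)
  open import Relation.Binary.PropositionalEquality

  plausible-density : ∀ k qs (distinct : DistinctPrimes qs) →
    (∀ p → p ≤ suc k → Prime p → p ∈ qs) →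
    ∀ β → k * β ≤ product (map pred qs) →
    ∀ A → Plausible2 (suc k) A →
    LiminfDensity≥ A (ℚ._/_ (+ β) (product qs) {{product-nonZero distinct}})
  plausible-density k qs distinct small-primes β kβ≤φ A plausible =
    density-from-counts A β P counts
    where
    instance
      P-nonZero : NonZero (product qs)
      P-nonZero = product-nonZero distinct
    open Differences k qs small-primes A plausible
    open Rounds distinct β kβ≤φ
    counts : ∀ N → SquareCount A β P N
    counts N with harvest ((suc (2 * N) ∸ P) / P)
    ... | D , _ , (D-unique , D-full) , D-weight =
          points N D , points-unique N D-unique (All.map proj₂ D-full) ,
          points-inSquare A symmetric N (All.map proj₁ D-full) ,
          subst (λ L → β * (X * X) ≤ P * (L + 3 * (β * X))) (sym (length-points N D))
            (density-estimate β P X V S (weight W D) (progression-bound P V) weight-bound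
              (≤-trans (n≤1+n X) (m≤n+m∸n W P)) (∸-monoʳ-≤ W (>-nonZero⁻¹ P)))
      where
      X W V S : ℕ
      X = 2 * N
      W = suc X
      V = W ∸ P
      S = ∑< (V / P) (λ j → V ∸ suc j * P)
      weight-bound : β * S ≤ weight W D
      weight-bound = subst (λ s → β * s ≤ weight W D)
        (∑-cong (V / P) (λ j → sym (∸-+-assoc W P (suc j * P)))) (D-weight W)

open import Defs
open import Data.Integer using (ℤ; +_)
open import Data.Product using (_×_)
open import Data.Rational as ℚ using (ℚ; _/_)
open Sieve
open GeneralBound
open import Data.Nat as ℕ using (ℕ; _≤_; _≟_; s≤s)
import Data.Nat.Properties as ℕ
open import Data.Nat.Primality using (Prime; prime?)
open import Data.Nat.ListAction using (product)
open import Data.List using (List; []; _∷_; map; upTo)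
open import Data.List.Relation.Unary.All as All using (All; all?)
open import Data.List.Relation.Unary.Unique.DecPropositional _≟_ using (unique?)
open import Data.List.Membership.Propositional using (_∈_)
open import Data.List.Membership.DecPropositional _≟_ using (_∈?_)
open import Data.List.Membership.Propositional.Properties using (∈-upTo⁺)
open import Data.Product using (_,_)
open import Relation.Nullary.Decidable using (toWitness; _×-dec_; _→-dec_)
open import Relation.Binary.PropositionalEquality

primes≤50 : List ℕ
primes≤50 = 2 ∷ 3 ∷ 5 ∷ 7 ∷ 11 ∷ 13 ∷ 17 ∷ 19 ∷ 23 ∷ 29 ∷ 31 ∷ 37 ∷ 41 ∷ 43 ∷ 47 ∷ []

primes≤50-distinct : DistinctPrimes primes≤50
primes≤50-distinct = toWitness {a? = all? prime? primes≤50 ×-dec unique? primes≤50} _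

primes≤50-complete : ∀ p → p ≤ 50 → Prime p → p ∈ primes≤50
primes≤50-complete p p≤50 = All.lookup checked (∈-upTo⁺ (s≤s p≤50))
  where
  checked : All (λ p → Prime p → p ∈ primes≤50) (upTo 51)
  checked = toWitness {a? = all? (λ p → prime? p →-dec p ∈? primes≤50) (upTo 51)} _

-- β = ∏_{p ≤ 50} (p − 1) / 49, so that β / ∏_{p ≤ 50} p is the bound of the theorem.
β : ℕ
β = 1740565905408000

49β≡totient : 49 ℕ.* β ≡ product (map ℕ.pred primes≤50)
49β≡totient = refl

bound≡ : bound ≡ ((+ β) / product primes≤50)
bound≡ = refl

mainTheorem3 : ((A : ℤ × ℤ → Set) → Plausible2 50 A → LiminfDensity≥ A bound)
               × ((+ 1) / 354) ℚ.< bound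
mainTheorem3 =
  (λ A plausible → subst (LiminfDensity≥ A) (sym bound≡)
     (plausible-density 49 primes≤50 primes≤50-distinct primes≤50-complete
        β (ℕ.≤-reflexive 49β≡totient) A plausible)) ,
  toWitness {a? = ((+ 1) / 354) ℚ.<? bound} _
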